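{- Let $n$ and $m$ be positive integers with $5\le n\le 2m+1$, and let $C=(i_1,\dots,i_p)$ be a cycle of length $p$ in $S_n$. (a) If $C\in L_m$, then $C$ can be written as a product of $p+1$ transpositions in $G_m$. (b) If $C\notin L_m$, then $C$ can be written as a product of $p-1$ transpositions in $G_m$. Furthermore, let $C_i=(i_1,\dots,i_p)$ and $C_j=(j_1,\dots,j_q)$ be two disjoint cycles in $L_m$. If there exist $1\le r\le p$ and $1\le s\le q$ such that $|i_t-j_s|\le m$ for all $t=1,\dots,p$ and $|j_u-i_r|\le m$ for all $u=1,\dots,q$, then $C_iC_j$ can be written as a product of $p+q$ transpositions in $G_m$.
   Context: $S_n$ is the symmetric group on $\{1,\dots,n\}$ with products being compositions. $G_m$ is the set of transpositions $(a,b)\in S_n$ with $1\le a<b\le n$ and $b-a\le m$. A cycle $C=(i_1,\dots,i_p)$ in $S_n$ is said to belong to the set $L_m$ if for each term $i_u$ of $C$ there is a term $i_v$ of $C$ with $|i_u-i_v|>m$; thus $C\notin L_m$ iff there is some $r$ with $|i_t-i_r|\le m$ for all $t=1,\dots,p$. -}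

module Defs where

open import Data.Nat using (ℕ; zero; suc; _+_; _≤_; _<_; _∸_; ∣_-_∣)
open import Data.Fin using (Fin; toℕ; _≟_)
open import Data.List using (List; []; _∷_; length; foldr; map)
open import Data.List.Relation.Unary.All using (All)
open import Data.List.Relation.Unary.Any using (Any)
open import Data.Product using (_×_; Σ; _,_)
open import Relation.Nullary using (¬_; yes; no)
open import Relation.Binary.PropositionalEquality using (_≡_)
open import Function using (_∘_; id)

-- Points 1..n of the paper are represented by Fin n (i ↦ i-1); distances
-- |a - b| are computed on toℕ, hence unchanged by the shift.

Perm : ℕ → Set
Perm n = Fin n → Fin n

_≗ₚ_ : ∀ {n} → Perm n → Perm n → Set
f ≗ₚ g = ∀ x → f x ≡ g x

dist : ∀ {n} → Fin n → Fin n → ℕ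
dist a b = ∣ toℕ a - toℕ b ∣

swap : ∀ {n} → Fin n → Fin n → Perm n
swap a b x with x ≟ a
... | yes _ = b
... | no _ with x ≟ b
...   | yes _ = a
...   | no _ = x

prod : ∀ {n} → List (Fin n × Fin n) → Perm n
prod = foldr (λ { (a , b) f → swap a b ∘ f }) id

InG : ∀ {n} → ℕ → Fin n × Fin n → Set
InG m (a , b) = toℕ a < toℕ b × toℕ b ∸ toℕ a ≤ m

-- cycle (i₁ … i_p) : i_k ↦ i_{k+1}, i_p ↦ i₁, everything else fixed
-- cycStep first a rest x : a is the current term, rest the following terms
cycStep : ∀ {n} → Fin n → Fin n → List (Fin n) → Perm n
cycStep first a [] x with x ≟ a
... | yes _ = first
... | no _ = x
cycStep first a (b ∷ r) x with x ≟ a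
... | yes _ = b
... | no _ = cycStep first b r x

cyc : ∀ {n} → List (Fin n) → Perm n
cyc [] = id
cyc (a ∷ r) = cycStep a a r

InL : ∀ {n} → ℕ → List (Fin n) → Set
InL m xs = All (λ u → Any (λ v → m < dist u v) xs) xs

ProdOfG : ∀ {n} → ℕ → ℕ → Perm n → Set
ProdOfG m k σ = Σ (List (Fin _ × Fin _)) λ ts →
  length ts ≡ k × All (InG m) ts × (prod ts ≗ₚ σ)

-- Every cycle (c x₁ … x_k) is the star product (c x_k)⋯(c x₁), which lies in G_m as soon as
-- c is within distance m of every xᵢ.  All factorisations used are consequences of the
-- splitting identity (a₁ … a_k b b₁ … b_l) = (a₁ … a_k b)(b b₁ … b_l) and of rotation
-- invariance of cycles.
-- (b) If C ∉ L_m, some term r of C is within m of all of C: rotate C to start at r and take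
--     the star at r, giving p − 1 transpositions.
-- (a) Since n ≤ 2m + 1, the middle point c of {1, …, n} is within m of every point, and c ∉ C
--     when C ∈ L_m.  Then (i₁ … i_p) = (i₁ c)(c i₁ … i_p) is a transposition times a star at c.
-- (c) Writing Ci = (i_r xs) and Cj = (j_s ys) after rotation,
--     (i_r xs)(j_s ys) = (i_r j_s)(j_s xs)(i_r j_s ys),
--     a transposition, a star at j_s with p − 1 factors and a star at i_r with q factors.

module Submission where

open import Defs
open import Data.Nat using (ℕ; suc; _+_; _*_; _≤_; _<_; _∸_; z≤n; _<?_; ∣_-_∣)
open import Data.Nat.Properties
  using (+-comm; +-identityʳ; <⇒≤; ≤-refl; ≤-trans; ≤-pred; ≤⇒≯; ≮⇒≥; m∸n≤m; m≤n+o⇒m∸n≤o; m≤n⇒∣m-n∣≡n∸m; ∣m-n∣≡[m∸n]∨[n∸m]; ∣-∣-comm)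
open import Data.Fin using (Fin; zero; toℕ; fromℕ<; _≟_)
open import Data.Fin.Properties using (toℕ<n; toℕ-fromℕ<; <-cmp)
open import Data.List using (List; []; _∷_; _++_; length)
open import Data.List.Properties using (length-++; ++-assoc; ++-identityʳ)
open import Data.List.Relation.Unary.All as All using (All; []; _∷_)
open import Data.List.Relation.Unary.All.Properties using (¬All⇒Any¬; ¬Any⇒All¬; ++⁺)
open import Data.List.Relation.Unary.Any as Any using (here; there)
open import Data.List.Relation.Unary.Unique.Propositional using (Unique; _∷_)
open import Data.List.Relation.Unary.Unique.Propositional.Properties using (Unique[x∷xs]⇒x∉xs)
open import Data.List.Relation.Binary.Disjoint.Propositional using (Disjoint)
open import Data.List.Relation.Binary.Permutation.Propositional using (_↭_; prep; ↭-trans; ↭-sym; ↭⇒↭ₛ)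
open import Data.List.Relation.Binary.Permutation.Propositional.Properties as ↭
  using (shift; ∷↭∷ʳ; All-resp-↭; ∈-resp-↭; ↭-length)
import Data.List.Relation.Binary.Permutation.Setoid.Properties as ↭ₛ
import Data.List.Relation.Unary.AllPairs as AllPairs
open import Data.List.Membership.Propositional using (_∈_; _∉_; find)
open import Data.List.Membership.Propositional.Properties using (∈-∃++; ∈-++⁺ʳ)
open import Data.Product using (_×_; Σ; ∃-syntax; _,_)
open import Data.Sum using (inj₁; inj₂)
open import Data.Empty using (⊥-elim)
open import Relation.Binary using (tri<; tri≈; tri>)
open import Relation.Binary.PropositionalEquality
  using (_≡_; _≢_; refl; sym; trans; cong; cong₂; subst; setoid; module ≡-Reasoning)
open import Relation.Nullary using (¬_; yes; no)
open import Function using (_∘_; id)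
open import Data.Fin.Permutation.Components using (transpose; transpose-inverse)

Unique-resp-↭ : ∀ {A : Set} {xs ys : List A} → xs ↭ ys → Unique xs → Unique ys
Unique-resp-↭ {A} p = ↭ₛ.Unique-resp-↭ (setoid A) (↭⇒↭ₛ p)

module _ {n : ℕ} where

  head∉suffix : ∀ {h : Fin n} as {bs} → Unique (h ∷ as ++ bs) → h ∉ bs
  head∉suffix as u = Unique[x∷xs]⇒x∉xs u ∘ ∈-++⁺ʳ as

  cycStep-next : ∀ (f a b : Fin n) r → cycStep f a (b ∷ r) a ≡ b
  cycStep-next f a b r with a ≟ a
  ... | yes _ = refl
  ... | no a≢a = ⊥-elim (a≢a refl)

  cycStep-last : ∀ (f a : Fin n) → cycStep f a [] a ≡ f
  cycStep-last f a with a ≟ a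
  ... | yes _ = refl
  ... | no a≢a = ⊥-elim (a≢a refl)

  cycStep-pass : ∀ (f a b : Fin n) r {x} → x ≢ a → cycStep f a (b ∷ r) x ≡ cycStep f b r x
  cycStep-pass f a b r {x} x≢a with x ≟ a
  ... | yes x≡a = ⊥-elim (x≢a x≡a)
  ... | no _ = refl

  cycStep-∉ : ∀ (f a : Fin n) r {x} → x ∉ a ∷ r → cycStep f a r x ≡ x
  cycStep-∉ f a [] {x} x∉ with x ≟ a
  ... | yes x≡a = ⊥-elim (x∉ (here x≡a))
  ... | no _ = refl
  cycStep-∉ f a (b ∷ r) {x} x∉ with x ≟ a
  ... | yes x≡a = ⊥-elim (x∉ (here x≡a))
  ... | no _ = cycStep-∉ f b r (x∉ ∘ there)

  cycStep-≢ : ∀ (f a : Fin n) r {x y} → y ≢ x → y ∉ f ∷ r → cycStep f a r x ≢ y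
  cycStep-≢ f a [] {x} y≢x y∉ with x ≟ a
  ... | yes _ = λ f≡y → y∉ (here (sym f≡y))
  ... | no _ = y≢x ∘ sym
  cycStep-≢ f a (b ∷ r) {x} y≢x y∉ with x ≟ a
  ... | yes _ = λ b≡y → y∉ (there (here (sym b≡y)))
  ... | no _ = cycStep-≢ f b r y≢x λ { (here y≡f) → y∉ (here y≡f) ; (there y∈r) → y∉ (there (there y∈r)) }

  cycStep-retarget : ∀ (f b a : Fin n) r {x} → b ∉ r → x ≢ b →
                     cycStep f a r x ≡ cycStep f b [] (cycStep b a r x)
  cycStep-retarget f b a [] {x} _ x≢b with x ≟ a
  ... | yes _ = sym (cycStep-last f b)
  ... | no _ = sym (cycStep-∉ f b [] λ { (here x≡b) → x≢b x≡b })
  cycStep-retarget f b a (c ∷ r) {x} b∉ x≢b with x ≟ a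
  ... | yes _ = sym (cycStep-∉ f b [] λ { (here c≡b) → b∉ (here (sym c≡b)) })
  ... | no _ = cycStep-retarget f b c r (b∉ ∘ there) x≢b

  cycStep-redirect : ∀ (f b : Fin n) r x → b ∉ r → cycStep f b r x ≡ cycStep f b [] (cycStep b b r x)
  cycStep-redirect f b r x b∉ with x ≟ b
  cycStep-redirect f b [] x b∉ | yes refl = sym (cong (cycStep f x []) (cycStep-last x x))
  cycStep-redirect f b (c ∷ r) x b∉ | yes refl = begin
    cycStep f x (c ∷ r) x               ≡⟨ cycStep-next f x c r ⟩
    c                                   ≡⟨ cycStep-∉ f x [] (λ { (here c≡x) → b∉ (here (sym c≡x)) }) ⟨
    cycStep f x [] c                    ≡⟨ cong (cycStep f x []) (cycStep-next x x c r) ⟨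
    cycStep f x [] (cycStep x x (c ∷ r) x) ∎
    where open ≡-Reasoning
  ... | no x≢b = cycStep-retarget f b b r b∉ x≢b

  cycStep-split : ∀ (f h : Fin n) as b bs → Unique (h ∷ as ++ b ∷ bs) →
                  ∀ x → cycStep f h (as ++ b ∷ bs) x ≡ cycStep f h (as ++ b ∷ []) (cycStep b b bs x)
  cycStep-split f h [] b bs u x with x ≟ h
  ... | yes refl =
    sym (trans (cong (cycStep f x (b ∷ [])) (cycStep-∉ b b bs (head∉suffix [] u))) (cycStep-next f x b []))
  ... | no x≢h =
    trans (cycStep-redirect f b bs x (Unique[x∷xs]⇒x∉xs (AllPairs.tail u)))
          (sym (cycStep-pass f h b [] (cycStep-≢ b b bs (x≢h ∘ sym) (head∉suffix [] u))))
  cycStep-split f h (a ∷ as) b bs u x with x ≟ h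
  ... | yes refl =
    sym (trans (cong (cycStep f x (a ∷ as ++ b ∷ [])) (cycStep-∉ b b bs (head∉suffix (a ∷ as) u)))
               (cycStep-next f x a (as ++ b ∷ [])))
  ... | no x≢h =
    trans (cycStep-split f a as b bs (AllPairs.tail u) x)
          (sym (cycStep-pass f h a (as ++ b ∷ []) (cycStep-≢ b b bs (x≢h ∘ sym) (head∉suffix (a ∷ as) u))))

  cyc-singleton : ∀ (a : Fin n) → cyc (a ∷ []) ≗ₚ id
  cyc-singleton a x with x ≟ a
  ... | yes x≡a = sym x≡a
  ... | no _ = refl

  cyc-split : ∀ as b bs → Unique (as ++ b ∷ bs) → cyc (as ++ b ∷ bs) ≗ₚ (cyc (as ++ b ∷ []) ∘ cyc (b ∷ bs))
  cyc-split [] b bs _ x = sym (cyc-singleton b (cyc (b ∷ bs) x))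
  cyc-split (h ∷ as) b bs u = cycStep-split h h as b bs u

  cycStep-snoc : ∀ (f h : Fin n) w a {x} → x ≢ a → cycStep f h (w ++ a ∷ []) x ≡ cycStep a h w x
  cycStep-snoc f h [] a {x} x≢a with x ≟ h
  ... | yes _ = refl
  ... | no _ = cycStep-∉ f a [] λ { (here x≡a) → x≢a x≡a }
  cycStep-snoc f h (c ∷ w) a {x} x≢a with x ≟ h
  ... | yes _ = refl
  ... | no _ = cycStep-snoc f c w a x≢a

  cycStep-snoc-last : ∀ (f h : Fin n) w a → a ∉ h ∷ w → cycStep f h (w ++ a ∷ []) a ≡ f
  cycStep-snoc-last f h [] a a∉ = trans (cycStep-pass f h a [] (a∉ ∘ here)) (cycStep-last f a)
  cycStep-snoc-last f h (c ∷ w) a a∉ =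
    trans (cycStep-pass f h c (w ++ a ∷ []) (a∉ ∘ here)) (cycStep-snoc-last f c w a (a∉ ∘ there))

  cyc-rotate₁ : ∀ a w → a ∉ w → cyc (a ∷ w) ≗ₚ cyc (w ++ a ∷ [])
  cyc-rotate₁ a [] _ x = refl
  cyc-rotate₁ a (b ∷ w) a∉ x with x ≟ a
  ... | yes refl = sym (cycStep-snoc-last b b w x a∉)
  ... | no x≢a = sym (cycStep-snoc b b w a x≢a)

  cyc-rotate : ∀ u v → Unique (u ++ v) → cyc (u ++ v) ≗ₚ cyc (v ++ u)
  cyc-rotate [] v _ x = cong (λ l → cyc l x) (sym (++-identityʳ v))
  cyc-rotate (a ∷ u) v a∷u++v x = begin
    cyc (a ∷ u ++ v) x          ≡⟨ cyc-rotate₁ a (u ++ v) (Unique[x∷xs]⇒x∉xs a∷u++v) x ⟩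
    cyc ((u ++ v) ++ a ∷ []) x  ≡⟨ cong (λ l → cyc l x) (++-assoc u v (a ∷ [])) ⟩
    cyc (u ++ v ++ a ∷ []) x    ≡⟨ cyc-rotate u (v ++ a ∷ []) u++v++a x ⟩
    cyc ((v ++ a ∷ []) ++ u) x  ≡⟨ cong (λ l → cyc l x) (++-assoc v (a ∷ []) u) ⟩
    cyc (v ++ a ∷ u) x          ∎
    where
    open ≡-Reasoning
    u++v++a : Unique (u ++ v ++ a ∷ [])
    u++v++a = subst Unique (++-assoc u v (a ∷ [])) (Unique-resp-↭ (∷↭∷ʳ a (u ++ v)) a∷u++v)

  cyc-rotateTo : ∀ {r : Fin n} {C} → r ∈ C → Unique C → ∃[ w ] C ↭ r ∷ w × cyc C ≗ₚ cyc (r ∷ w)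
  cyc-rotateTo {r} r∈C u with ∈-∃++ r∈C
  ... | us , vs , refl = vs ++ us , ↭-trans (shift r us vs) (prep r (↭.++-comm us vs)) , cyc-rotate us (r ∷ vs) u

  cyc-pair≗swap : ∀ (a b : Fin n) → cyc (a ∷ b ∷ []) ≗ₚ swap a b
  cyc-pair≗swap a b x with x ≟ a
  ... | yes _ = refl
  ... | no _ with x ≟ b
  ...   | yes _ = refl
  ...   | no _ = refl

  cyc-pair≗transpose : ∀ (a b : Fin n) → cyc (a ∷ b ∷ []) ≗ₚ transpose a b
  cyc-pair≗transpose a b x with x ≟ a
  ... | yes _ = refl
  ... | no _ with x ≟ b
  ...   | yes _ = refl
  ...   | no _ = refl

  cyc-pair-comm : ∀ {a b : Fin n} → a ≢ b → cyc (a ∷ b ∷ []) ≗ₚ cyc (b ∷ a ∷ [])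
  cyc-pair-comm {a} {b} a≢b = cyc-rotate₁ a (b ∷ []) λ { (here a≡b) → a≢b a≡b }

  cyc-pair-inverse : ∀ (a b : Fin n) → (cyc (a ∷ b ∷ []) ∘ cyc (b ∷ a ∷ [])) ≗ₚ id
  cyc-pair-inverse a b x = begin
    cyc (a ∷ b ∷ []) (cyc (b ∷ a ∷ []) x) ≡⟨ cyc-pair≗transpose a b (cyc (b ∷ a ∷ []) x) ⟩
    transpose a b (cyc (b ∷ a ∷ []) x)    ≡⟨ cong (transpose a b) (cyc-pair≗transpose b a x) ⟩
    transpose a b (transpose b a x)       ≡⟨ transpose-inverse a b ⟩
    x                                     ∎
    where open ≡-Reasoning

  cyc-peel : ∀ c x xs → Unique (c ∷ x ∷ xs) → cyc (c ∷ x ∷ xs) ≗ₚ (cyc (c ∷ xs) ∘ cyc (c ∷ x ∷ []))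
  cyc-peel c x xs u y = begin
    cyc (c ∷ x ∷ xs) y
      ≡⟨ cyc-rotate (c ∷ x ∷ []) xs u y ⟩
    cyc (xs ++ c ∷ x ∷ []) y
      ≡⟨ cyc-split xs c (x ∷ []) (Unique-resp-↭ (↭.++-comm (c ∷ x ∷ []) xs) u) y ⟩
    cyc (xs ++ c ∷ []) (cyc (c ∷ x ∷ []) y)
      ≡⟨ cyc-rotate₁ c xs (Unique[x∷xs]⇒x∉xs u ∘ there) (cyc (c ∷ x ∷ []) y) ⟨
    cyc (c ∷ xs) (cyc (c ∷ x ∷ []) y)
      ∎
    where open ≡-Reasoning

  cyc-∘-rewire : ∀ {ir js : Fin n} xs ys → Unique (js ∷ ir ∷ xs) → Unique (ir ∷ js ∷ ys) →
                 (cyc (ir ∷ xs) ∘ cyc (js ∷ ys)) ≗ₚ (cyc (ir ∷ js ∷ []) ∘ cyc (js ∷ xs) ∘ cyc (ir ∷ js ∷ ys))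
  cyc-∘-rewire {ir} {js} xs ys js∷ir∷xs! ir∷js∷ys! y = sym (begin
    cyc (ir ∷ js ∷ []) (cyc (js ∷ xs) (cyc (ir ∷ js ∷ ys) y))
      ≡⟨ cong (cyc (ir ∷ js ∷ []) ∘ cyc (js ∷ xs)) (cyc-split (ir ∷ []) js ys ir∷js∷ys! y) ⟩
    cyc (ir ∷ js ∷ []) (cyc (js ∷ xs) (cyc (ir ∷ js ∷ []) z))
      ≡⟨ cong (cyc (ir ∷ js ∷ []) ∘ cyc (js ∷ xs)) (cyc-pair-comm ir≢js z) ⟩
    cyc (ir ∷ js ∷ []) (cyc (js ∷ xs) (cyc (js ∷ ir ∷ []) z))
      ≡⟨ cong (cyc (ir ∷ js ∷ [])) (cyc-peel js ir xs js∷ir∷xs! z) ⟨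
    cyc (ir ∷ js ∷ []) (cyc (js ∷ ir ∷ xs) z)
      ≡⟨ cong (cyc (ir ∷ js ∷ [])) (cyc-split (js ∷ []) ir xs js∷ir∷xs! z) ⟩
    cyc (ir ∷ js ∷ []) (cyc (js ∷ ir ∷ []) (cyc (ir ∷ xs) z))
      ≡⟨ cyc-pair-inverse ir js (cyc (ir ∷ xs) z) ⟩
    cyc (ir ∷ xs) z
      ∎)
    where
    open ≡-Reasoning
    z : Fin n
    z = cyc (js ∷ ys) y
    ir≢js : ir ≢ js
    ir≢js = All.head (AllPairs.head ir∷js∷ys!)

module _ {n m : ℕ} where

  prod-++ : (ts us : List (Fin n × Fin n)) → prod (ts ++ us) ≗ₚ (prod ts ∘ prod us)
  prod-++ [] us x = refl
  prod-++ ((a , b) ∷ ts) us x = cong (swap a b) (prod-++ ts us x)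

  ProdOfG-resp : ∀ {k} {σ τ : Perm n} → σ ≗ₚ τ → ProdOfG m k σ → ProdOfG m k τ
  ProdOfG-resp σ≗τ (ts , len , tsG , ts≗σ) = ts , len , tsG , λ x → trans (ts≗σ x) (σ≗τ x)

  ProdOfG-∘ : ∀ {k l} {σ τ : Perm n} → ProdOfG m k σ → ProdOfG m l τ → ProdOfG m (k + l) (σ ∘ τ)
  ProdOfG-∘ {σ = σ} (ts , refl , tsG , ts≗σ) (us , refl , usG , us≗τ) =
    ts ++ us , length-++ ts , ++⁺ tsG usG ,
    λ x → trans (prod-++ ts us x) (trans (ts≗σ (prod us x)) (cong σ (us≗τ x)))

  dist≤-comm : ∀ (a b : Fin n) → dist a b ≤ m → dist b a ≤ m
  dist≤-comm a b = subst (_≤ m) (∣-∣-comm (toℕ a) (toℕ b))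

  InG-ordered : ∀ {a b : Fin n} → toℕ a < toℕ b → dist a b ≤ m → InG m (a , b)
  InG-ordered a<b d = a<b , subst (_≤ m) (m≤n⇒∣m-n∣≡n∸m (<⇒≤ a<b)) d

  ProdOfG-transposition : ∀ {a b : Fin n} → a ≢ b → dist a b ≤ m → ProdOfG m 1 (cyc (a ∷ b ∷ []))
  ProdOfG-transposition {a} {b} a≢b d with <-cmp a b
  ... | tri< a<b _ _ = (a , b) ∷ [] , refl , InG-ordered a<b d ∷ [] , sym ∘ cyc-pair≗swap a b
  ... | tri≈ _ a≡b _ = ⊥-elim (a≢b a≡b)
  ... | tri> _ _ b<a = (b , a) ∷ [] , refl , InG-ordered b<a (dist≤-comm a b d) ∷ [] ,
                       λ x → sym (trans (cyc-pair-comm a≢b x) (cyc-pair≗swap b a x))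

  ProdOfG-star : ∀ c xs → Unique (c ∷ xs) → All (λ x → dist c x ≤ m) xs → ProdOfG m (length xs) (cyc (c ∷ xs))
  ProdOfG-star c [] _ [] = [] , refl , [] , sym ∘ cyc-singleton c
  ProdOfG-star c (x ∷ xs) u@((c≢x ∷ c≢xs) ∷ _ ∷ xs!) (d ∷ ds) =
    ProdOfG-resp (sym ∘ cyc-peel c x xs u)
      (subst (λ k → ProdOfG m k (cyc (c ∷ xs) ∘ cyc (c ∷ x ∷ []))) (+-comm (length xs) 1)
        (ProdOfG-∘ (ProdOfG-star c xs (c≢xs ∷ xs!) ds) (ProdOfG-transposition c≢x d)))

  InL-avoids-centre : ∀ {c : Fin n} {C} → (∀ x → dist c x ≤ m) → InL m C → c ∉ C
  InL-avoids-centre near inL c∈C with Any.satisfied (All.lookup inL c∈C)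
  ... | v , far = ≤⇒≯ (near v) far

  ¬InL⇒∃centre : ∀ {C : List (Fin n)} → ¬ InL m C → ∃[ r ] r ∈ C × All (λ v → dist r v ≤ m) C
  ¬InL⇒∃centre {C} ¬inL with find (¬All⇒Any¬ (λ u → Any.any? (λ v → m <? dist u v) C) C ¬inL)
  ... | r , r∈C , ¬far = r , r∈C , All.map ≮⇒≥ (¬Any⇒All¬ C ¬far)

  ProdOfG-cyc-InL : ∀ (c : Fin n) → (∀ y → dist c y ≤ m) → ∀ x xs → Unique (x ∷ xs) → InL m (x ∷ xs) →
                    ProdOfG m (length (x ∷ xs) + 1) (cyc (x ∷ xs))
  ProdOfG-cyc-InL c near x xs u inL =
    ProdOfG-resp cyc≗
      (subst (λ k → ProdOfG m k (cyc (x ∷ c ∷ []) ∘ cyc (c ∷ x ∷ xs))) (+-comm 1 (length (x ∷ xs)))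
        (ProdOfG-∘ (ProdOfG-transposition (All.head c∉ ∘ sym) (dist≤-comm c x (near x)))
                   (ProdOfG-star c (x ∷ xs) c∷x∷xs! (All.tabulate λ {y} _ → near y))))
    where
    c∉ : All (c ≢_) (x ∷ xs)
    c∉ = ¬Any⇒All¬ (x ∷ xs) (InL-avoids-centre near inL)
    c∷x∷xs! : Unique (c ∷ x ∷ xs)
    c∷x∷xs! = c∉ ∷ u
    cyc≗ : (cyc (x ∷ c ∷ []) ∘ cyc (c ∷ x ∷ xs)) ≗ₚ cyc (x ∷ xs)
    cyc≗ y = begin
      cyc (x ∷ c ∷ []) (cyc (c ∷ x ∷ xs) y)
        ≡⟨ cong (cyc (x ∷ c ∷ [])) (cyc-split (c ∷ []) x xs c∷x∷xs! y) ⟩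
      cyc (x ∷ c ∷ []) (cyc (c ∷ x ∷ []) (cyc (x ∷ xs) y))
        ≡⟨ cyc-pair-inverse x c (cyc (x ∷ xs) y) ⟩
      cyc (x ∷ xs) y
        ∎
      where open ≡-Reasoning

  ProdOfG-cyc-¬InL : ∀ (C : List (Fin n)) → Unique C → ¬ InL m C → ProdOfG m (length C ∸ 1) (cyc C)
  ProdOfG-cyc-¬InL C u ¬inL with ¬InL⇒∃centre ¬inL
  ... | r , r∈C , near with cyc-rotateTo r∈C u
  ... | w , C↭r∷w , cycC≗ =
    ProdOfG-resp (sym ∘ cycC≗)
      (subst (λ k → ProdOfG m (k ∸ 1) (cyc (r ∷ w))) (sym (↭-length C↭r∷w))
        (ProdOfG-star r w (Unique-resp-↭ C↭r∷w u) (All.tail (All-resp-↭ C↭r∷w near))))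

  ProdOfG-cyc-∘ : ∀ (Ci Cj : List (Fin n)) {ir js} → Unique Ci → Unique Cj → Disjoint Ci Cj →
                  ir ∈ Ci → js ∈ Cj → All (λ it → dist it js ≤ m) Ci → All (λ ju → dist ju ir ≤ m) Cj →
                  ProdOfG m (length Ci + length Cj) (cyc Ci ∘ cyc Cj)
  ProdOfG-cyc-∘ Ci Cj {ir} {js} ui uj disj ir∈Ci js∈Cj nearJ nearI
    with cyc-rotateTo ir∈Ci ui | cyc-rotateTo js∈Cj uj
  ... | xs , Ci↭ , cycCi≗ | ys , Cj↭ , cycCj≗ =
    ProdOfG-resp cyc≗
      (subst (λ k → ProdOfG m k (cyc (ir ∷ js ∷ []) ∘ cyc (js ∷ xs) ∘ cyc (ir ∷ js ∷ ys)))
             (sym (cong₂ _+_ (↭-length Ci↭) (↭-length Cj↭)))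
        (ProdOfG-∘ (ProdOfG-transposition (All.head ir∉) (All.lookup nearJ ir∈Ci))
          (ProdOfG-∘ (ProdOfG-star js xs (All.tail js∉ ∷ AllPairs.tail ir∷xs!)
                                     (All.map (λ {x} → dist≤-comm x js) (All.tail (All-resp-↭ Ci↭ nearJ))))
                     (ProdOfG-star ir (js ∷ ys) (ir∉ ∷ js∷ys!) (All.map (λ {y} → dist≤-comm y ir) (All-resp-↭ Cj↭ nearI))))))
    where
    ir∷xs! : Unique (ir ∷ xs)
    ir∷xs! = Unique-resp-↭ Ci↭ ui
    js∷ys! : Unique (js ∷ ys)
    js∷ys! = Unique-resp-↭ Cj↭ uj
    js∉ : All (js ≢_) (ir ∷ xs)
    js∉ = ¬Any⇒All¬ (ir ∷ xs) λ js∈ → disj (∈-resp-↭ (↭-sym Ci↭) js∈ , js∈Cj)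
    ir∉ : All (ir ≢_) (js ∷ ys)
    ir∉ = ¬Any⇒All¬ (js ∷ ys) λ ir∈ → disj (ir∈Ci , ∈-resp-↭ (↭-sym Cj↭) ir∈)
    cyc≗ : (cyc (ir ∷ js ∷ []) ∘ cyc (js ∷ xs) ∘ cyc (ir ∷ js ∷ ys)) ≗ₚ (cyc Ci ∘ cyc Cj)
    cyc≗ y = begin
      cyc (ir ∷ js ∷ []) (cyc (js ∷ xs) (cyc (ir ∷ js ∷ ys) y))
        ≡⟨ cyc-∘-rewire xs ys (js∉ ∷ ir∷xs!) (ir∉ ∷ js∷ys!) y ⟨
      cyc (ir ∷ xs) (cyc (js ∷ ys) y)
        ≡⟨ cycCi≗ (cyc (js ∷ ys) y) ⟨
      cyc Ci (cyc (js ∷ ys) y)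
        ≡⟨ cong (cyc Ci) (cycCj≗ y) ⟨
      cyc Ci (cyc Cj y)
        ∎
      where open ≡-Reasoning

∣i-k∣≤m : ∀ {i k m} → i ≤ m → k ≤ i + m → ∣ i - k ∣ ≤ m
∣i-k∣≤m {i} {k} i≤m k≤i+m with ∣m-n∣≡[m∸n]∨[n∸m] i k
... | inj₁ eq = subst (_≤ _) (sym eq) (≤-trans (m∸n≤m i k) i≤m)
... | inj₂ eq = subst (_≤ _) (sym eq) (m≤n+o⇒m∸n≤o k i k≤i+m)

Fin-centre : ∀ {n} m → suc n ≤ 2 * m + 1 → ∃[ c ] ∀ (x : Fin (suc n)) → dist c x ≤ m
Fin-centre {n} m n≤2m+1 with m <? suc n
... | yes m<n = fromℕ< m<n , λ x →
  subst (λ i → ∣ i - toℕ x ∣ ≤ m) (sym (toℕ-fromℕ< m<n)) (∣i-k∣≤m ≤-refl (toℕ≤m+m x))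
  where
  2m+1≡1+m+m : 2 * m + 1 ≡ suc (m + m)
  2m+1≡1+m+m = trans (+-comm (2 * m) 1) (cong (λ j → suc (m + j)) (+-identityʳ m))
  toℕ≤m+m : (x : Fin (suc n)) → toℕ x ≤ m + m
  toℕ≤m+m x = ≤-pred (≤-trans (toℕ<n x) (subst (suc n ≤_) 2m+1≡1+m+m n≤2m+1))
... | no m≮n = zero , λ x → ∣i-k∣≤m z≤n (≤-trans (<⇒≤ (toℕ<n x)) (≮⇒≥ m≮n))

lemma2p4 : (n m : ℕ) → 1 ≤ m → 5 ≤ n → n ≤ 2 * m + 1 →
    ((C : List (Fin n)) → Unique C → 2 ≤ length C →
      (InL m C → ProdOfG m (length C + 1) (cyc C))
      × (¬ InL m C → ProdOfG m (length C ∸ 1) (cyc C)))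
    × ((Ci Cj : List (Fin n)) → Unique Ci → 2 ≤ length Ci → Unique Cj → 2 ≤ length Cj →
      Disjoint Ci Cj → InL m Ci → InL m Cj →
      Σ (Fin n) (λ ir → Σ (Fin n) (λ js → ir ∈ Ci × js ∈ Cj
        × All (λ it → dist it js ≤ m) Ci × All (λ ju → dist ju ir ≤ m) Cj)) →
      ProdOfG m (length Ci + length Cj) (cyc Ci ∘ cyc Cj))
lemma2p4 (suc n) m _ _ n≤2m+1 with Fin-centre m n≤2m+1
... | c , near =
  (λ { (x ∷ xs) u _ → ProdOfG-cyc-InL c near x xs u , ProdOfG-cyc-¬InL (x ∷ xs) u }) ,
  λ { Ci Cj ui _ uj _ disj _ _ (ir , js , ir∈Ci , js∈Cj , nearJ , nearI) →
        ProdOfG-cyc-∘ Ci Cj ui uj disj ir∈Ci js∈Cj nearJ nearI }
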